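{- Consider an execution of Random Order Greedy (see context) with an arbitrary fixed permutation $\pi$. For every subset $S\subseteq\mathcal{N}$, every base $T$ of the partition matroid, and every $0\le i\le m$, \[ f(A_m)+f(S\cup A_m) \ge f(A_i)+f(S\cup A_i\cup T^{(i)}) \ge f(S\cup T). \]
   Context: $\mathcal{N}$ is a finite ground set partitioned into non-empty disjoint sets $P_1,\dots,P_m$; $f\colon 2^{\mathcal{N}}\to\mathbb{R}_{\ge0}$ is non-negative, monotone ($f(S)\le f(T)$ for $S\subseteq T$) and submodular. A base of the partition matroid is a set containing exactly one element of each $P_j$. Write $f(u\mid A)=f(A\cup\{u\})-f(A)$. Random Order Greedy: $A_0=\varnothing$; $\pi$ is a permutation of $\{1,\dots,m\}$ (uniformly random in the algorithm); for $i=1,\dots,m$, $u_i$ is an element $u\in P_{\pi(i)}$ maximizing $f(u\mid A_{i-1})$, and $A_i=A_{i-1}\cup\{u_i\}$. For $T\subseteq\mathcal{N}$ and $0\le i\le m$, $T^{(i)} = T\setminus\bigcup_{j=1}^{i}P_{\pi(j)}$. -}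

module Defs where

open import Level using (0ℓ)
open import Data.Nat using (ℕ; zero; suc; _<?_)
open import Data.Fin using (Fin; fromℕ<; _≟_; toℕ)
open import Data.Fin.Subset using (Subset; ⊥; ⁅_⁆; _∪_; _∩_; _∈_; _⊆_)
open import Data.Vec using (tabulate)
open import Data.Sum using (_⊎_)
open import Data.Product using (∃-syntax; _×_)
open import Relation.Binary.PropositionalEquality using (_≡_)
open import Relation.Nullary.Decidable using (yes; no; ⌊_⌋)

-- A totally ordered abelian group (values of f).  ℝ is an instance, so
-- stating the result for every such structure covers the real-valued case.
record OrderedAbelianGroup : Set₁ where
  infixl 6 _+_ _-_
  infix 4 _≤_
  field
    Carrier : Set
    _+_     : Carrier → Carrier → Carrier
    0#      : Carrier
    -_      : Carrier → Carrier
    _≤_     : Carrier → Carrier → Set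
    +-assoc     : ∀ x y z → (x + y) + z ≡ x + (y + z)
    +-comm      : ∀ x y → x + y ≡ y + x
    +-identityʳ : ∀ x → x + 0# ≡ x
    +-inverseʳ  : ∀ x → x + (- x) ≡ 0#
    ≤-refl      : ∀ {x} → x ≤ x
    ≤-trans     : ∀ {x y z} → x ≤ y → y ≤ z → x ≤ z
    ≤-antisym   : ∀ {x y} → x ≤ y → y ≤ x → x ≡ y
    ≤-total     : ∀ x y → (x ≤ y) ⊎ (y ≤ x)
    +-monoˡ-≤   : ∀ {x y} z → x ≤ y → x + z ≤ y + z

  _-_ : Carrier → Carrier → Carrier
  x - y = x + (- y)



module _ (G : OrderedAbelianGroup) where
  open OrderedAbelianGroup G

  module _ {n : ℕ} (f : Subset n → Carrier) where
    NonNegative : Set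
    NonNegative = ∀ S → 0# ≤ f S

    Monotone : Set
    Monotone = ∀ S T → S ⊆ T → f S ≤ f T

    Submodular : Set
    Submodular = ∀ S T → f (S ∪ T) + f (S ∩ T) ≤ f S + f T

    marginal : Fin n → Subset n → Carrier
    marginal u A = f (A ∪ ⁅ u ⁆) - f A

-- Union of g(0), ..., g(i-1) (indices ≥ m are ignored).
prefixUnion : ∀ {m n} → (Fin m → Subset n) → ℕ → Subset n
prefixUnion g zero = ⊥
prefixUnion {m} g (suc i) with i <? m
... | yes p = prefixUnion g i ∪ g (fromℕ< p)
... | no _  = prefixUnion g i

module _ {n m : ℕ} (part : Fin n → Fin m) where
  Block : Fin m → Subset n
  Block j = tabulate (λ x → ⌊ part x ≟ j ⌋)

  NonEmptyBlocks : Set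
  NonEmptyBlocks = ∀ j → ∃[ x ] (part x ≡ j)

  IsBase : Subset n → Set
  IsBase T = (∀ j → ∃[ x ] (x ∈ T × part x ≡ j))
           × (∀ x y → x ∈ T → y ∈ T → part x ≡ part y → x ≡ y)

  -- T^(i) = T \ (P_π(1) ∪ … ∪ P_π(i)), with π given as a function (0-based)
  restrict : (Fin m → Fin m) → Subset n → ℕ → Subset n
  restrict π T i = T ∩ Data.Fin.Subset.∁ (prefixUnion (λ j → Block (π j)) i)

-- A_i = {u_1, …, u_i}, with u given 0-based (u j is the paper's u_(j+1))
greedySet : ∀ {m n} → (Fin m → Fin n) → ℕ → Subset n
greedySet u i = prefixUnion (λ j → ⁅ u j ⁆) i

-- Along the run, the potential Φ(i) = f(A_i) + f(S ∪ A_i ∪ T^(i)) never decreases.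
-- In step i+1 the block P_π(i+1) leaves T^(i) exactly one element t of the base T,
-- so S ∪ A_i ∪ T^(i) is covered by B = S ∪ A_(i+1) ∪ T^(i+1) and A_i + t, while A_i
-- lies in both; submodularity and the greedy choice f(A_i + t) ≤ f(A_(i+1)) then give
-- Φ(i) ≤ Φ(i+1).  At the ends, Φ(0) ≥ f(S ∪ T) since f(∅) ≥ 0, and T^(m) = ∅.
module Submission where

open import Defs
open import Level using (0ℓ)
open import Data.Nat as Nat using (ℕ; zero; suc; _<?_; z≤n)
import Data.Nat.Properties as ℕ
open import Data.Fin using (Fin; toℕ; fromℕ<; _≟_)
open import Data.Fin.Properties using (toℕ<n; fromℕ<-toℕ; toℕ-fromℕ<)
open import Data.Fin.Subset using (Subset; ⊥; ⁅_⁆; _∪_; _∩_; _∈_; _∉_; _⊆_)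
open import Data.Fin.Subset.Properties
  using (p⊆p∪q; q⊆p∪q; x∈p∪q⁻; x∈p∩q⁺; x∈p∩q⁻; x∈⁅x⁆; ∉⊥; x∉p⇒x∈∁p; x∈∁p⇒x∉p; x∈p⇒x∉∁p)
open import Data.Fin.Permutation using (Permutation′; _⟨$⟩ʳ_; _⟨$⟩ˡ_; inverseʳ)
open import Data.Vec.Properties using (lookup∘tabulate; lookup⇒[]=; []=⇒lookup)
open import Data.Bool.Properties using (T-≡)
open import Data.Product using (∃-syntax; _×_; _,_; proj₁; proj₂)
open import Data.Sum using (inj₁; inj₂; [_,_])
open import Data.Empty using (⊥-elim)
open import Function using (_∘_; Equivalence)
open import Relation.Nullary using (yes; no; contradiction)
open import Relation.Nullary.Decidable using (fromWitness; toWitness)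
open import Relation.Binary using (Preorder)
open import Relation.Binary.PropositionalEquality
  using (_≡_; refl; sym; trans; cong; subst; isEquivalence)

∪-least : ∀ {n} {P Q R : Subset n} → P ⊆ R → Q ⊆ R → P ∪ Q ⊆ R
∪-least P⊆R Q⊆R x∈P∪Q = [ P⊆R , Q⊆R ] (x∈p∪q⁻ _ _ x∈P∪Q)

module _ {m n : ℕ} (g : Fin m → Subset n) where

  prefixUnion-suc : ∀ j → prefixUnion g (suc (toℕ j)) ≡ prefixUnion g (toℕ j) ∪ g j
  prefixUnion-suc j with toℕ j <? m
  ... | yes j<m = cong (λ k → prefixUnion g (toℕ j) ∪ g k) (fromℕ<-toℕ j j<m)
  ... | no  j≮m = contradiction (toℕ<n j) j≮m

  prefixUnion-⊆-suc : ∀ i → prefixUnion g i ⊆ prefixUnion g (suc i)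
  prefixUnion-⊆-suc i with i <? m
  ... | yes _ = p⊆p∪q _
  ... | no  _ = λ x∈ → x∈

  ⊆-prefixUnion : ∀ j i → toℕ j Nat.< i → g j ⊆ prefixUnion g i
  ⊆-prefixUnion j (suc i) j<1+i x∈gj with ℕ.m<1+n⇒m<n∨m≡n j<1+i
  ... | inj₁ j<i  = prefixUnion-⊆-suc i (⊆-prefixUnion j i j<i x∈gj)
  ... | inj₂ refl = subst (_ ∈_) (sym (prefixUnion-suc j)) (q⊆p∪q _ _ x∈gj)

module _ {n m : ℕ} (part : Fin n → Fin m) where

  ∈-Block⁺ : ∀ {x j} → part x ≡ j → x ∈ Block part j
  ∈-Block⁺ {x} {j} eq =
    lookup⇒[]= x _
      (trans (lookup∘tabulate _ x) (Equivalence.to T-≡ (fromWitness {a? = part x ≟ j} eq)))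

  ∈-Block⁻ : ∀ {x j} → x ∈ Block part j → part x ≡ j
  ∈-Block⁻ {x} {j} x∈Pj =
    toWitness {a? = part x ≟ j}
      (Equivalence.from T-≡ (trans (sym (lookup∘tabulate _ x)) ([]=⇒lookup x∈Pj)))

  IsBase⇒∩-Block⊆⁅⁆ : ∀ {T t j} → IsBase part T → t ∈ T → part t ≡ j → T ∩ Block part j ⊆ ⁅ t ⁆
  IsBase⇒∩-Block⊆⁅⁆ {T} {t} (_ , unique) t∈T pt x∈T∩Pj with x∈p∩q⁻ T _ x∈T∩Pj
  ... | x∈T , x∈Pj =
    subst (_∈ ⁅ t ⁆) (sym (unique _ t x∈T t∈T (trans (∈-Block⁻ x∈Pj) (sym pt)))) (x∈⁅x⁆ t)

  module _ (π : Fin m → Fin m) (T : Subset n) where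

    restrict-zero : T ⊆ restrict part π T 0
    restrict-zero x∈T = x∈p∩q⁺ (x∈T , x∉p⇒x∈∁p ∉⊥)

    restrict-suc : ∀ j →
      restrict part π T (toℕ j) ⊆ restrict part π T (suc (toℕ j)) ∪ (T ∩ Block part (π j))
    restrict-suc j {x} x∈R with x∈p∩q⁻ T _ x∈R | part x ≟ π j
    ... | x∈T , _   | yes x∈Pj = q⊆p∪q _ _ (x∈p∩q⁺ (x∈T , ∈-Block⁺ x∈Pj))
    ... | x∈T , x∉Q | no  x∉Pj = p⊆p∪q _ (x∈p∩q⁺ (x∈T , x∉p⇒x∈∁p x∉Q′))
      where
      x∉Q′ : x ∉ prefixUnion (Block part ∘ π) (suc (toℕ j))
      x∉Q′ x∈Q′ = [ x∈∁p⇒x∉p x∉Q , x∉Pj ∘ ∈-Block⁻ ]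
                    (x∈p∪q⁻ _ _ (subst (x ∈_) (prefixUnion-suc (Block part ∘ π) j) x∈Q′))

    restrict-full : (∀ j → ∃[ k ] π k ≡ j) → ∀ {x} → x ∉ restrict part π T m
    restrict-full surjective {x} x∈R with surjective (part x)
    ... | k , πk≡px =
      x∈p⇒x∉∁p (⊆-prefixUnion (Block part ∘ π) k m (toℕ<n k) (∈-Block⁺ (sym πk≡px)))
               (proj₂ (x∈p∩q⁻ T _ x∈R))

module OrderedAbelianGroupProperties (G : OrderedAbelianGroup) where
  open OrderedAbelianGroup G

  ≤-preorder : Preorder 0ℓ 0ℓ 0ℓ
  ≤-preorder = record
    { Carrier    = Carrier
    ; _≈_        = _≡_
    ; _≲_        = _≤_
    ; isPreorder = record
      { isEquivalence = isEquivalence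
      ; reflexive     = λ { refl → ≤-refl }
      ; trans         = ≤-trans
      }
    }

  open import Relation.Binary.Reasoning.Preorder ≤-preorder public

  +-identityˡ : ∀ x → 0# + x ≡ x
  +-identityˡ x = trans (+-comm 0# x) (+-identityʳ x)

  +-monoʳ-≤ : ∀ {x y} z → x ≤ y → z + x ≤ z + y
  +-monoʳ-≤ {x} {y} z x≤y = begin
    z + x ≡⟨ +-comm z x ⟩
    x + z ≲⟨ +-monoˡ-≤ z x≤y ⟩
    y + z ≡⟨ +-comm y z ⟩
    z + y ∎

  +-mono-≤ : ∀ {x y z w} → x ≤ y → z ≤ w → x + z ≤ y + w
  +-mono-≤ {y = y} {z} x≤y z≤w = ≤-trans (+-monoˡ-≤ z x≤y) (+-monoʳ-≤ y z≤w)

  x-y+y≡x : ∀ x y → x - y + y ≡ x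
  x-y+y≡x x y = trans (+-assoc x (- y) y)
    (trans (cong (x +_) (trans (+-comm (- y) y) (+-inverseʳ y))) (+-identityʳ x))

  x-z≤y-z⇒x≤y : ∀ {x y} z → x - z ≤ y - z → x ≤ y
  x-z≤y-z⇒x≤y {x} {y} z x-z≤y-z = begin
    x         ≡⟨ sym (x-y+y≡x x z) ⟩
    x - z + z ≲⟨ +-monoˡ-≤ z x-z≤y-z ⟩
    y - z + z ≡⟨ x-y+y≡x y z ⟩
    y         ∎

  ≤-stepwise : ∀ {m} (Φ : ℕ → Carrier) → (∀ (j : Fin m) → Φ (toℕ j) ≤ Φ (suc (toℕ j))) →
               ∀ {i k} → i Nat.≤ k → k Nat.≤ m → Φ i ≤ Φ k
  ≤-stepwise Φ step {k = zero}  z≤n _ = ≤-refl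
  ≤-stepwise Φ step {k = suc k} i≤1+k 1+k≤m with ℕ.m≤n⇒m<n∨m≡n i≤1+k
  ... | inj₂ refl = ≤-refl
  ... | inj₁ i<1+k = ≤-trans (≤-stepwise Φ step (ℕ.≤-pred i<1+k) (ℕ.<⇒≤ 1+k≤m))
                             (subst (λ l → Φ l ≤ Φ (suc l)) (toℕ-fromℕ< 1+k≤m) (step (fromℕ< 1+k≤m)))

  module _ {n : ℕ} (f : Subset n → Carrier) where

    marginal-≤⇒≤ : ∀ {v w A} → marginal G f v A ≤ marginal G f w A → f (A ∪ ⁅ v ⁆) ≤ f (A ∪ ⁅ w ⁆)
    marginal-≤⇒≤ {A = A} = x-z≤y-z⇒x≤y (f A)

    submodular-cover : Monotone G f → Submodular G f →
      ∀ {X Z} B Y → X ⊆ B ∪ Y → Z ⊆ B ∩ Y → f X + f Z ≤ f B + f Y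
    submodular-cover mono sub B Y X⊆B∪Y Z⊆B∩Y =
      ≤-trans (+-mono-≤ (mono _ _ X⊆B∪Y) (mono _ _ Z⊆B∩Y)) (sub B Y)

module _ (G : OrderedAbelianGroup) where
  open OrderedAbelianGroup G

  GreedyRun : ∀ {n m} → (Fin n → Fin m) → (Subset n → Carrier) →
              (Fin m → Fin m) → (Fin m → Fin n) → Set
  GreedyRun part f π u = ∀ j →
      (part (u j) ≡ π j)
    × (∀ v → part v ≡ π j →
         marginal G f v (greedySet u (toℕ j)) ≤ marginal G f (u j) (greedySet u (toℕ j)))

module GreedyPotential
  (G : OrderedAbelianGroup)
  {n m : ℕ} (part : Fin n → Fin m)
  (f : Subset n → OrderedAbelianGroup.Carrier G) (mono : Monotone G f) (sub : Submodular G f)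
  (π : Fin m → Fin m) (u : Fin m → Fin n) (greedy : GreedyRun G part f π u)
  (S T : Subset n) (base : IsBase part T)
  where

  open OrderedAbelianGroup G
  open OrderedAbelianGroupProperties G

  potential : ℕ → Carrier
  potential i = f (greedySet u i) + f (S ∪ greedySet u i ∪ restrict part π T i)

  potential-initial : NonNegative G f → f (S ∪ T) ≤ potential 0
  potential-initial nonneg = begin
    f (S ∪ T)      ≡⟨ sym (+-identityˡ _) ⟩
    0# + f (S ∪ T) ≲⟨ +-mono-≤ (nonneg ⊥) (mono _ _ S∪T⊆) ⟩
    potential 0    ∎
    where
    S∪T⊆ : S ∪ T ⊆ S ∪ ⊥ ∪ restrict part π T 0
    S∪T⊆ = ∪-least (p⊆p∪q _) (q⊆p∪q S _ ∘ q⊆p∪q ⊥ _ ∘ restrict-zero part π T)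

  potential-final : (∀ j → ∃[ k ] π k ≡ j) →
    potential m ≤ f (greedySet u m) + f (S ∪ greedySet u m)
  potential-final surjective = +-monoʳ-≤ (f (greedySet u m)) (mono _ _ R⊆)
    where
    R⊆ : S ∪ greedySet u m ∪ restrict part π T m ⊆ S ∪ greedySet u m
    R⊆ = ∪-least (p⊆p∪q _) (∪-least (q⊆p∪q S _) (⊥-elim ∘ restrict-full part π T surjective))

  potential-suc : ∀ j → potential (toℕ j) ≤ potential (suc (toℕ j))
  potential-suc j with proj₁ base (π j)
  ... | t , t∈T , pt = begin
    f A + f (S ∪ A ∪ R)  ≡⟨ +-comm _ _ ⟩
    f (S ∪ A ∪ R) + f A  ≲⟨ submodular-cover f mono sub B (A ∪ ⁅ t ⁆) cover shared ⟩
    f B + f (A ∪ ⁅ t ⁆)  ≲⟨ +-monoʳ-≤ (f B) gain ⟩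
    f B + f A′           ≡⟨ +-comm _ _ ⟩
    f A′ + f B           ∎
    where
    A A′ R B : Subset n
    A  = greedySet u (toℕ j)
    A′ = greedySet u (suc (toℕ j))
    R  = restrict part π T (toℕ j)
    B  = S ∪ A′ ∪ restrict part π T (suc (toℕ j))

    A′≡A+uj : A′ ≡ A ∪ ⁅ u j ⁆
    A′≡A+uj = prefixUnion-suc (λ k → ⁅ u k ⁆) j

    A⊆B : A ⊆ B
    A⊆B = q⊆p∪q S _ ∘ p⊆p∪q _ ∘ prefixUnion-⊆-suc (λ k → ⁅ u k ⁆) (toℕ j)

    cover : S ∪ A ∪ R ⊆ B ∪ (A ∪ ⁅ t ⁆)
    cover = ∪-least (p⊆p∪q _ ∘ p⊆p∪q _) (∪-least (q⊆p∪q B _ ∘ p⊆p∪q _)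
      (∪-least (p⊆p∪q _ ∘ q⊆p∪q S _ ∘ q⊆p∪q A′ _)
               (q⊆p∪q B _ ∘ q⊆p∪q A _ ∘ IsBase⇒∩-Block⊆⁅⁆ part base t∈T pt)
      ∘ restrict-suc part π T j))

    shared : A ⊆ B ∩ (A ∪ ⁅ t ⁆)
    shared x∈A = x∈p∩q⁺ (A⊆B x∈A , p⊆p∪q _ x∈A)

    gain : f (A ∪ ⁅ t ⁆) ≤ f A′
    gain = subst (λ Z → f (A ∪ ⁅ t ⁆) ≤ f Z) (sym A′≡A+uj)
                 (marginal-≤⇒≤ f (proj₂ (greedy j) t pt))

  potential-mono : ∀ {i k} → i Nat.≤ k → k Nat.≤ m → potential i ≤ potential k
  potential-mono = ≤-stepwise potential potential-suc

corollary3p3 :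
    (G : OrderedAbelianGroup) → let open OrderedAbelianGroup G in
    ∀ {n m : ℕ} (part : Fin n → Fin m) → NonEmptyBlocks part →
    (f : Subset n → Carrier) →
    NonNegative G f → Monotone G f → Submodular G f →
    (π : Permutation′ m) (u : Fin m → Fin n) →
    (∀ (j : Fin m) →
        (part (u j) ≡ π ⟨$⟩ʳ j)
      × (∀ v → part v ≡ π ⟨$⟩ʳ j →
           marginal G f v (greedySet u (toℕ j))
             ≤ marginal G f (u j) (greedySet u (toℕ j)))) →
    ∀ (S T : Subset n) → IsBase part T →
    ∀ (i : ℕ) → i Nat.≤ m →
      (f (greedySet u i) + f (S ∪ greedySet u i ∪ restrict part (π ⟨$⟩ʳ_) T i)
         ≤ f (greedySet u m) + f (S ∪ greedySet u m))
    × (f (S ∪ T)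
         ≤ f (greedySet u i) + f (S ∪ greedySet u i ∪ restrict part (π ⟨$⟩ʳ_) T i))
corollary3p3 G part _ f nonneg mono sub π u greedy S T base i i≤m =
    ≤-trans (potential-mono i≤m ℕ.≤-refl) (potential-final (λ j → π ⟨$⟩ˡ j , inverseʳ π))
  , ≤-trans (potential-initial nonneg) (potential-mono z≤n i≤m)
  where
  open OrderedAbelianGroup G using (≤-trans)
  open GreedyPotential G part f mono sub (π ⟨$⟩ʳ_) u greedy S T base
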